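{- For every intuitionistic modal logic $\mathbf{L}$ contained in $\mathbf{L}_{\mathbf{fbdc}}$, the logic $\mathbf{L}\oplus(p\vee\neg p)$ is equal to the classical modal logic $\mathbf{K}$.
   Context: Formulas are built from a countably infinite set of atoms by $A::=p\mid (A\rightarrow A)\mid\top\mid\bot\mid(A\vee A)\mid(A\wedge A)\mid\square A\mid\lozenge A$; $\neg A$ abbreviates $A\rightarrow\bot$. An intuitionistic modal logic is a set of formulas closed under uniform substitution, containing the axioms of intuitionistic propositional logic, closed under modus ponens, containing (A1) $\square(p\rightarrow q)\rightarrow(\square p\rightarrow\square q)$, (A2) $\square(p\vee q)\rightarrow((\lozenge p\rightarrow\square q)\rightarrow\square q)$, (A3) $\lozenge(p\vee q)\rightarrow\lozenge p\vee\lozenge q$, (A4) $\neg\lozenge\bot$, and closed under (R1) from $p$ infer $\square p$, (R2) from $p\rightarrow q$ infer $\lozenge p\rightarrow\lozenge q$, (R3) from $\lozenge p\rightarrow q\vee\square(p\rightarrow r)$ infer $\lozenge p\rightarrow q\vee\lozenge r$. $\mathbf{L}_{\min}$ is the least one; $\mathbf{L}\oplus\Sigma$ the least one containing $\mathbf{L}$ and $\Sigma$. $\mathbf{L}_{\mathbf{fbdc}}=\mathbf{L}_{\min}\oplus\{\lozenge(p\rightarrow q)\rightarrow(\square p\rightarrow\lozenge q),\ (\lozenge p\rightarrow\square q)\rightarrow\square(p\rightarrow q),\ \square(p\vee q)\rightarrow\lozenge p\vee\square q\}$. $\mathbf{K}$ is the least set of formulas in this language containing all classical tautologies, $\square(p\rightarrow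 q)\rightarrow(\square p\rightarrow\square q)$ and $\lozenge p\leftrightarrow\neg\square\neg p$, closed under modus ponens, necessitation (from $A$ infer $\square A$) and uniform substitution; equivalently, the set of formulas valid in all classical Kripke frames. -}

module Defs where

open import Data.Nat using (ℕ)
open import Data.Bool using (Bool; true; false; _∧_; _∨_; not)
open import Data.Empty using (⊥)
open import Data.Sum using (_⊎_)
open import Data.Product using (_×_)
open import Relation.Binary.PropositionalEquality using (_≡_)

infixr 5 _⇒_
infixr 6 _∨′_
infixr 7 _∧′_
data Fm : Set where
  atom : ℕ → Fm
  _⇒_  : Fm → Fm → Fm
  ⊤′   : Fm
  ⊥′   : Fm
  _∨′_ : Fm → Fm → Fm
  _∧′_ : Fm → Fm → Fm
  □    : Fm → Fm
  ◇    : Fm → Fm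

¬′ : Fm → Fm
¬′ A = A ⇒ ⊥′

_⇔_ : Fm → Fm → Fm
A ⇔ B = (A ⇒ B) ∧′ (B ⇒ A)

p q r : Fm
p = atom 0
q = atom 1
r = atom 2

sub : (ℕ → Fm) → Fm → Fm
sub σ (atom n) = σ n
sub σ (A ⇒ B)  = sub σ A ⇒ sub σ B
sub σ ⊤′       = ⊤′
sub σ ⊥′       = ⊥′
sub σ (A ∨′ B) = sub σ A ∨′ sub σ B
sub σ (A ∧′ B) = sub σ A ∧′ sub σ B
sub σ (□ A)    = □ (sub σ A)
sub σ (◇ A)    = ◇ (sub σ A)

FmSet : Set₁
FmSet = Fm → Set

_⊆_ : FmSet → FmSet → Set
L ⊆ M = ∀ {A} → L A → M A

_≐_ : FmSet → FmSet → Set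
L ≐ M = (L ⊆ M) × (M ⊆ L)

data IPCAx : Fm → Set where
  k    : ∀ A B → IPCAx (A ⇒ B ⇒ A)
  s    : ∀ A B C → IPCAx ((A ⇒ B ⇒ C) ⇒ (A ⇒ B) ⇒ A ⇒ C)
  ∧e₁  : ∀ A B → IPCAx (A ∧′ B ⇒ A)
  ∧e₂  : ∀ A B → IPCAx (A ∧′ B ⇒ B)
  ∧i   : ∀ A B → IPCAx (A ⇒ B ⇒ A ∧′ B)
  ∨i₁  : ∀ A B → IPCAx (A ⇒ A ∨′ B)
  ∨i₂  : ∀ A B → IPCAx (B ⇒ A ∨′ B)
  ∨e   : ∀ A B C → IPCAx ((A ⇒ C) ⇒ (B ⇒ C) ⇒ A ∨′ B ⇒ C)
  ⊥e   : ∀ A → IPCAx (⊥′ ⇒ A)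
  ⊤i   : IPCAx ⊤′

data ModAx : Fm → Set where
  A1 : ModAx (□ (p ⇒ q) ⇒ □ p ⇒ □ q)
  A2 : ModAx (□ (p ∨′ q) ⇒ (◇ p ⇒ □ q) ⇒ □ q)
  A3 : ModAx (◇ (p ∨′ q) ⇒ ◇ p ∨′ ◇ q)
  A4 : ModAx (¬′ (◇ ⊥′))

record IsIML (L : FmSet) : Set where
  field
    subst-closed : ∀ σ {A} → L A → L (sub σ A)
    ipc          : ∀ {A} → IPCAx A → L A
    mp           : ∀ {A B} → L (A ⇒ B) → L A → L B
    modax        : ∀ {A} → ModAx A → L A
    R1           : ∀ {A} → L A → L (□ A)
    R2           : ∀ {A B} → L (A ⇒ B) → L (◇ A ⇒ ◇ B)
    R3           : ∀ {A B C} → L (◇ A ⇒ B ∨′ □ (A ⇒ C)) → L (◇ A ⇒ B ∨′ ◇ C)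

data Gen (S : FmSet) : FmSet where
  base  : ∀ {A} → S A → Gen S A
  sb    : ∀ σ {A} → Gen S A → Gen S (sub σ A)
  ipc   : ∀ {A} → IPCAx A → Gen S A
  mp    : ∀ {A B} → Gen S (A ⇒ B) → Gen S A → Gen S B
  modax : ∀ {A} → ModAx A → Gen S A
  R1    : ∀ {A} → Gen S A → Gen S (□ A)
  R2    : ∀ {A B} → Gen S (A ⇒ B) → Gen S (◇ A ⇒ ◇ B)
  R3    : ∀ {A B C} → Gen S (◇ A ⇒ B ∨′ □ (A ⇒ C)) → Gen S (◇ A ⇒ B ∨′ ◇ C)

Lmin : FmSet
Lmin = Gen (λ _ → ⊥)

_⊕_ : FmSet → FmSet → FmSet
L ⊕ Σ′ = Gen (λ A → L A ⊎ Σ′ A)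

data FbdcAx : Fm → Set where
  fbdc1 : FbdcAx (◇ (p ⇒ q) ⇒ □ p ⇒ ◇ q)
  fbdc2 : FbdcAx ((◇ p ⇒ □ q) ⇒ □ (p ⇒ q))
  fbdc3 : FbdcAx (□ (p ∨′ q) ⇒ ◇ p ∨′ □ q)

Lfbdc : FmSet
Lfbdc = Lmin ⊕ FbdcAx

data LEM : Fm → Set where
  lem : LEM (p ∨′ ¬′ p)

-- Classical truth-functional evaluation: atoms and modalised formulas are
-- treated as propositional variables.
eval : (Fm → Bool) → Fm → Bool
eval v (atom n) = v (atom n)
eval v (A ⇒ B)  = not (eval v A) ∨ eval v B
eval v ⊤′       = true
eval v ⊥′       = false
eval v (A ∨′ B) = eval v A ∨ eval v B
eval v (A ∧′ B) = eval v A ∧ eval v B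
eval v (□ A)    = v (□ A)
eval v (◇ A)    = v (◇ A)

-- Substitution instances of classical propositional tautologies
Taut : FmSet
Taut A = ∀ (v : Fm → Bool) → eval v A ≡ true

data K : FmSet where
  taut : ∀ {A} → Taut A → K A
  kax  : K (□ (p ⇒ q) ⇒ □ p ⇒ □ q)
  dual : K (◇ p ⇔ ¬′ (□ (¬′ p)))
  mp   : ∀ {A B} → K (A ⇒ B) → K A → K B
  nec  : ∀ {A} → K A → K (□ A)
  sb   : ∀ σ {A} → K A → K (sub σ A)

-- L ⊕ (p ∨ ¬p) ⊆ K: every axiom and rule of L_fbdc, and excluded middle, is valid in K once
-- ◇ is read as ¬□¬, using only regularity of □ and truth-table reasoning.
-- K ⊆ L ⊕ (p ∨ ¬p): with excluded middle, Kalmár's argument derives every tautology from the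
-- intuitionistic axioms; necessitation is R1, the K axiom is A1, and the duality ◇p ↔ ¬□¬p
-- comes from A4 with R3 (◇p → ¬□¬p) and from A2 applied to □(p ∨ ¬p) (¬□¬p → ◇p).
module Submission where

open import Defs
open import Data.Bool using (Bool; true; false; T; not; _∧_; _∨_)
open import Data.Bool.Properties using (T-≡)
open import Data.Empty using (⊥-elim)
open import Data.List using (List; []; _∷_; _++_; deduplicate)
open import Data.List.Membership.Propositional using (_∈_)
open import Data.List.Membership.Propositional.Properties using (∈-++⁺ˡ; ∈-++⁺ʳ; ∈-deduplicate⁺)
open import Data.List.Relation.Binary.Permutation.Propositional using (↭-sym)
open import Data.List.Relation.Binary.Permutation.Propositional.Properties using (∈-resp-↭; shift)
open import Data.List.Relation.Unary.All using (All; []; _∷_; tabulate)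
open import Data.List.Relation.Unary.Any using (here; there)
open import Data.Maybe as Maybe using (Maybe; just; nothing; zipWith)
open import Data.Nat using (ℕ; zero; suc)
import Data.Nat.Properties as ℕ
open import Data.Product using (_×_; _,_)
open import Data.Sum using (inj₂; [_,_])
open import Function using (_∘_)
open import Function.Bundles using (Equivalence)
open import Relation.Binary.Definitions using (DecidableEquality)
open import Relation.Binary.PropositionalEquality
  using (_≡_; _≢_; refl; sym; trans; cong; cong₂; subst; module ≡-Reasoning)
open import Relation.Nullary using (yes; no)
open import Relation.Nullary.Decidable using (dec⇒maybe)

variable
  A B C : Fm
  Γ Δ : List Fm

_≡?_ : (A B : Fm) → Maybe (A ≡ B)
atom m   ≡? atom n   = Maybe.map (cong atom) (dec⇒maybe (m ℕ.≟ n))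
(A ⇒ B)  ≡? (C ⇒ D)  = zipWith (cong₂ _⇒_) (A ≡? C) (B ≡? D)
⊤′       ≡? ⊤′       = just refl
⊥′       ≡? ⊥′       = just refl
(A ∨′ B) ≡? (C ∨′ D) = zipWith (cong₂ _∨′_) (A ≡? C) (B ≡? D)
(A ∧′ B) ≡? (C ∧′ D) = zipWith (cong₂ _∧′_) (A ≡? C) (B ≡? D)
□ A      ≡? □ B      = Maybe.map (cong □) (A ≡? B)
◇ A      ≡? ◇ B      = Maybe.map (cong ◇) (A ≡? B)
_        ≡? _        = nothing

≡?-refl : ∀ A → A ≡? A ≡ just refl
≡?-refl (atom n) rewrite ℕ.≟-diag (refl {x = n}) = refl
≡?-refl (A ⇒ B)  rewrite ≡?-refl A | ≡?-refl B = refl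
≡?-refl ⊤′       = refl
≡?-refl ⊥′       = refl
≡?-refl (A ∨′ B) rewrite ≡?-refl A | ≡?-refl B = refl
≡?-refl (A ∧′ B) rewrite ≡?-refl A | ≡?-refl B = refl
≡?-refl (□ A)    rewrite ≡?-refl A = refl
≡?-refl (◇ A)    rewrite ≡?-refl A = refl

_≟_ : DecidableEquality Fm
A ≟ B with A ≡? B in eq
... | just A≡B = yes A≡B
... | nothing  = no λ { refl → just≢nothing (trans (sym (≡?-refl A)) eq) }
  where
  just≢nothing : just (refl {x = A}) ≢ nothing
  just≢nothing ()

letters : Fm → List Fm
letters (atom n) = atom n ∷ []
letters (A ⇒ B)  = letters A ++ letters B
letters ⊤′       = []
letters ⊥′       = []
letters (A ∨′ B) = letters A ++ letters B
letters (A ∧′ B) = letters A ++ letters B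
letters (□ A)    = □ A ∷ []
letters (◇ A)    = ◇ A ∷ []

eval-cong : ∀ A {v w : Fm → Bool} → (∀ {X} → X ∈ letters A → v X ≡ w X) → eval v A ≡ eval w A
eval-cong (atom n) v≗w = v≗w (here refl)
eval-cong (A ⇒ B)  v≗w = cong₂ (λ a b → not a ∨ b)
  (eval-cong A (v≗w ∘ ∈-++⁺ˡ)) (eval-cong B (v≗w ∘ ∈-++⁺ʳ (letters A)))
eval-cong ⊤′       v≗w = refl
eval-cong ⊥′       v≗w = refl
eval-cong (A ∨′ B) v≗w = cong₂ _∨_
  (eval-cong A (v≗w ∘ ∈-++⁺ˡ)) (eval-cong B (v≗w ∘ ∈-++⁺ʳ (letters A)))
eval-cong (A ∧′ B) v≗w = cong₂ _∧_
  (eval-cong A (v≗w ∘ ∈-++⁺ˡ)) (eval-cong B (v≗w ∘ ∈-++⁺ʳ (letters A)))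
eval-cong (□ A)    v≗w = v≗w (here refl)
eval-cong (◇ A)    v≗w = v≗w (here refl)

Assignment : List Fm → Set
Assignment = All (λ _ → Bool)

valuation : (ys : List Fm) → Assignment ys → Fm → Bool
valuation []       []       X = false
valuation (y ∷ ys) (b ∷ bs) X with X ≟ y
... | yes _ = b
... | no  _ = valuation ys bs X

restrict : (Fm → Bool) → (ys : List Fm) → Assignment ys
restrict v ys = tabulate (λ {X} _ → v X)

valuation-restrict : ∀ v {ys X} → X ∈ ys → valuation ys (restrict v ys) X ≡ v X
valuation-restrict v {y ∷ ys} {X} X∈ with X ≟ y | X∈
... | yes refl | _          = refl
... | no  X≢y  | here X≡y   = ⊥-elim (X≢y X≡y)
... | no  _    | there X∈ys = valuation-restrict v X∈ys

Everywhere : (ys : List Fm) → (Assignment ys → Bool) → Set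
Everywhere []       f = T (f [])
Everywhere (y ∷ ys) f = Everywhere ys (λ bs → f (true ∷ bs)) × Everywhere ys (λ bs → f (false ∷ bs))

everywhere : ∀ ys {f} → Everywhere ys f → ∀ bs → T (f bs)
everywhere []       t       []           = t
everywhere (y ∷ ys) (t , _) (true  ∷ bs) = everywhere ys t bs
everywhere (y ∷ ys) (_ , t) (false ∷ bs) = everywhere ys t bs

-- For a closed tautology this truth table normalises to a unit type, so it can be left as an
-- implicit argument for Agda to fill in; deduplicating the letters keeps the table small.
IsTautology : Fm → Set
IsTautology A = Everywhere ys (λ bs → eval (valuation ys bs) A)
  where ys = deduplicate _≟_ (letters A)

IsTautology⇒Taut : ∀ A → IsTautology A → Taut A
IsTautology⇒Taut A t v = begin
  eval v A                              ≡⟨ eval-cong A (sym ∘ valuation-restrict v ∘ ∈-deduplicate⁺ _≟_) ⟩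
  eval (valuation ys (restrict v ys)) A ≡⟨ Equivalence.to T-≡ (everywhere ys t _) ⟩
  true                                  ∎
  where
  open ≡-Reasoning
  ys = deduplicate _≟_ (letters A)

⟨_⟩ : List Fm → ℕ → Fm
⟨ []     ⟩ _       = ⊥′
⟨ A ∷ As ⟩ zero    = A
⟨ A ∷ As ⟩ (suc n) = ⟨ As ⟩ n

K-tautology : {IsTautology A} → K A
K-tautology {A} {t} = taut (IsTautology⇒Taut A t)

K-dual : ∀ A → K (◇ A ⇔ ¬′ (□ (¬′ A)))
K-dual A = sb ⟨ A ∷ [] ⟩ dual

K-regular : K (A ⇒ B) → K (□ A ⇒ □ B)
K-regular {A} {B} d = mp (sb ⟨ A ∷ B ∷ [] ⟩ kax) (nec d)

K-regular₂ : K (A ⇒ B ⇒ C) → K (□ A ⇒ □ B ⇒ □ C)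
K-regular₂ {A} {B} {C} d =
  mp (mp (sb ⟨ □ A ∷ □ (B ⇒ C) ∷ (□ B ⇒ □ C) ∷ [] ⟩ (K-tautology {(p ⇒ q) ⇒ (q ⇒ r) ⇒ p ⇒ r}))
         (K-regular d))
     (sb ⟨ B ∷ C ∷ [] ⟩ kax)

IPCAx⊆K : IPCAx ⊆ K
IPCAx⊆K (k A B)     = sb ⟨ A ∷ B ∷ [] ⟩ (K-tautology {p ⇒ q ⇒ p})
IPCAx⊆K (s A B C)   = sb ⟨ A ∷ B ∷ C ∷ [] ⟩ (K-tautology {(p ⇒ q ⇒ r) ⇒ (p ⇒ q) ⇒ p ⇒ r})
IPCAx⊆K (∧e₁ A B)   = sb ⟨ A ∷ B ∷ [] ⟩ (K-tautology {p ∧′ q ⇒ p})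
IPCAx⊆K (∧e₂ A B)   = sb ⟨ A ∷ B ∷ [] ⟩ (K-tautology {p ∧′ q ⇒ q})
IPCAx⊆K (∧i A B)    = sb ⟨ A ∷ B ∷ [] ⟩ (K-tautology {p ⇒ q ⇒ p ∧′ q})
IPCAx⊆K (∨i₁ A B)   = sb ⟨ A ∷ B ∷ [] ⟩ (K-tautology {p ⇒ p ∨′ q})
IPCAx⊆K (∨i₂ A B)   = sb ⟨ A ∷ B ∷ [] ⟩ (K-tautology {q ⇒ p ∨′ q})
IPCAx⊆K (∨e A B C)  = sb ⟨ A ∷ B ∷ C ∷ [] ⟩ (K-tautology {(p ⇒ r) ⇒ (q ⇒ r) ⇒ p ∨′ q ⇒ r})
IPCAx⊆K (⊥e A)      = sb ⟨ A ∷ [] ⟩ (K-tautology {⊥′ ⇒ p})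
IPCAx⊆K ⊤i          = K-tautology

□-disjunctive-syllogism : K (□ (p ∨′ q) ⇒ □ (¬′ p) ⇒ □ q)
□-disjunctive-syllogism = K-regular₂ (K-tautology {p ∨′ q ⇒ ¬′ p ⇒ q})

ModAx⊆K : ModAx ⊆ K
ModAx⊆K A1 = kax
ModAx⊆K A2 = mp (mp K-tautology □-disjunctive-syllogism) (K-dual p)
ModAx⊆K A3 = mp (mp (mp (mp K-tautology
  (K-regular₂ (K-tautology {¬′ p ⇒ ¬′ q ⇒ ¬′ (p ∨′ q)})))
  (K-dual p)) (K-dual q)) (K-dual (p ∨′ q))
ModAx⊆K A4 = mp (mp K-tautology (nec (K-tautology {¬′ ⊥′}))) (K-dual ⊥′)

FbdcAx⊆K : FbdcAx ⊆ K
FbdcAx⊆K fbdc1 = mp (mp (mp K-tautology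
  (K-regular₂ (K-tautology {p ⇒ ¬′ q ⇒ ¬′ (p ⇒ q)})))
  (K-dual (p ⇒ q))) (K-dual q)
FbdcAx⊆K fbdc2 = mp (mp (mp K-tautology
  (K-regular (K-tautology {¬′ p ⇒ p ⇒ q})))
  (K-regular (K-tautology {q ⇒ p ⇒ q}))) (K-dual p)
FbdcAx⊆K fbdc3 = mp (mp K-tautology □-disjunctive-syllogism) (K-dual p)

K-R2 : K (A ⇒ B) → K (◇ A ⇒ ◇ B)
K-R2 {A} {B} d = mp (sb ⟨ A ∷ B ∷ [] ⟩ ◇-mono) (K-regular (mp (sb ⟨ A ∷ B ∷ [] ⟩ contraposition) d))
  where
  contraposition : K ((p ⇒ q) ⇒ ¬′ q ⇒ ¬′ p)
  contraposition = K-tautology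
  ◇-mono : K ((□ (¬′ q) ⇒ □ (¬′ p)) ⇒ ◇ p ⇒ ◇ q)
  ◇-mono = mp (mp K-tautology (K-dual p)) (K-dual q)

K-R3 : K (◇ A ⇒ B ∨′ □ (A ⇒ C)) → K (◇ A ⇒ B ∨′ ◇ C)
K-R3 {A} {B} {C} = mp (sb ⟨ A ∷ B ∷ C ∷ [] ⟩ R3-valid)
  where
  R3-valid : K ((◇ p ⇒ q ∨′ □ (p ⇒ r)) ⇒ ◇ p ⇒ q ∨′ ◇ r)
  R3-valid = mp (mp (mp K-tautology
    (K-regular₂ (K-tautology {(p ⇒ r) ⇒ ¬′ r ⇒ ¬′ p})))
    (K-dual p)) (K-dual r)

Gen⊆K : ∀ {S} → S ⊆ K → Gen S ⊆ K
Gen⊆K S⊆K (base a)  = S⊆K a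
Gen⊆K S⊆K (sb σ d)  = sb σ (Gen⊆K S⊆K d)
Gen⊆K S⊆K (ipc a)   = IPCAx⊆K a
Gen⊆K S⊆K (mp d e)  = mp (Gen⊆K S⊆K d) (Gen⊆K S⊆K e)
Gen⊆K S⊆K (modax a) = ModAx⊆K a
Gen⊆K S⊆K (R1 d)    = nec (Gen⊆K S⊆K d)
Gen⊆K S⊆K (R2 d)    = K-R2 (Gen⊆K S⊆K d)
Gen⊆K S⊆K (R3 d)    = K-R3 (Gen⊆K S⊆K d)

Lfbdc⊆K : Lfbdc ⊆ K
Lfbdc⊆K = Gen⊆K [ Gen⊆K (λ ()) , FbdcAx⊆K ]

lit : Bool → Fm → Fm
lit true  A = A
lit false A = ¬′ A

literals : (ys : List Fm) → Assignment ys → List Fm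
literals []       []       = []
literals (y ∷ ys) (b ∷ bs) = lit b y ∷ literals ys bs

lit-valuation∈literals : ∀ {ys} bs {X} → X ∈ ys → lit (valuation ys bs X) X ∈ literals ys bs
lit-valuation∈literals {y ∷ ys} (b ∷ bs) {X} X∈ with X ≟ y | X∈
... | yes refl | _          = here refl
... | no  X≢y  | here X≡y   = ⊥-elim (X≢y X≡y)
... | no  _    | there X∈ys = there (lit-valuation∈literals bs X∈ys)

module Kalmar {L : FmSet} (ipc : IPCAx ⊆ L) (mp : ∀ {A B} → L (A ⇒ B) → L A → L B)
              (lem : ∀ A → L (A ∨′ ¬′ A)) where

  infix 3 _⊢_
  data _⊢_ (Γ : List Fm) : Fm → Set where
    hyp : A ∈ Γ → Γ ⊢ A
    thm : L A → Γ ⊢ A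
    app : Γ ⊢ A ⇒ B → Γ ⊢ A → Γ ⊢ B

  weaken : (_∈ Γ) ⊆ (_∈ Δ) → Γ ⊢ A → Δ ⊢ A
  weaken Γ⊆Δ (hyp A∈Γ) = hyp (Γ⊆Δ A∈Γ)
  weaken Γ⊆Δ (thm a)   = thm a
  weaken Γ⊆Δ (app d e) = app (weaken Γ⊆Δ d) (weaken Γ⊆Δ e)

  axiom : IPCAx A → Γ ⊢ A
  axiom a = thm (ipc a)

  ⊢-closed : [] ⊢ A → L A
  ⊢-closed (thm a)   = a
  ⊢-closed (app d e) = mp (⊢-closed d) (⊢-closed e)

  identity : Γ ⊢ A ⇒ A
  identity {A = A} = app (app (axiom (s A (A ⇒ A) A)) (axiom (k A (A ⇒ A)))) (axiom (k A A))

  deduction : A ∷ Γ ⊢ B → Γ ⊢ A ⇒ B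
  deduction (hyp (here refl)) = identity
  deduction (hyp (there B∈Γ)) = app (axiom (k _ _)) (hyp B∈Γ)
  deduction (thm b)           = app (axiom (k _ _)) (thm b)
  deduction (app d e)         = app (app (axiom (s _ _ _)) (deduction d)) (deduction e)

  ex-falso : Γ ⊢ ⊥′ → Γ ⊢ A
  ex-falso = app (axiom (⊥e _))

  cases : Γ ⊢ A ⇒ C → Γ ⊢ B ⇒ C → Γ ⊢ A ∨′ B → Γ ⊢ C
  cases f g d = app (app (app (axiom (∨e _ _ _)) f) g) d

  weaken₁ : Γ ⊢ A → B ∷ Γ ⊢ A
  weaken₁ = weaken there

  ⇒-lit : ∀ a b → Γ ⊢ lit a A → Γ ⊢ lit b B → Γ ⊢ lit (not a ∨ b) (A ⇒ B)
  ⇒-lit true  true  a b = app (axiom (k _ _)) b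
  ⇒-lit true  false a b = deduction (app (weaken₁ b) (app (hyp (here refl)) (weaken₁ a)))
  ⇒-lit false _     a b = deduction (ex-falso (app (weaken₁ a) (hyp (here refl))))

  ∨-lit : ∀ a b → Γ ⊢ lit a A → Γ ⊢ lit b B → Γ ⊢ lit (a ∨ b) (A ∨′ B)
  ∨-lit true  _     a b = app (axiom (∨i₁ _ _)) a
  ∨-lit false true  a b = app (axiom (∨i₂ _ _)) b
  ∨-lit false false a b = deduction (cases (weaken₁ a) (weaken₁ b) (hyp (here refl)))

  ∧-lit : ∀ a b → Γ ⊢ lit a A → Γ ⊢ lit b B → Γ ⊢ lit (a ∧ b) (A ∧′ B)
  ∧-lit true  true  a b = app (app (axiom (∧i _ _)) a) b
  ∧-lit true  false a b = deduction (app (weaken₁ b) (app (axiom (∧e₂ _ _)) (hyp (here refl))))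
  ∧-lit false _     a b = deduction (app (weaken₁ a) (app (axiom (∧e₁ _ _)) (hyp (here refl))))

  kalmar : ∀ v A → (∀ {X} → X ∈ letters A → Γ ⊢ lit (v X) X) → Γ ⊢ lit (eval v A) A
  kalmar v (atom n) ⊢X = ⊢X (here refl)
  kalmar v (A ⇒ B)  ⊢X = ⇒-lit (eval v A) (eval v B)
    (kalmar v A (⊢X ∘ ∈-++⁺ˡ)) (kalmar v B (⊢X ∘ ∈-++⁺ʳ (letters A)))
  kalmar v ⊤′       ⊢X = axiom ⊤i
  kalmar v ⊥′       ⊢X = identity
  kalmar v (A ∨′ B) ⊢X = ∨-lit (eval v A) (eval v B)
    (kalmar v A (⊢X ∘ ∈-++⁺ˡ)) (kalmar v B (⊢X ∘ ∈-++⁺ʳ (letters A)))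
  kalmar v (A ∧′ B) ⊢X = ∧-lit (eval v A) (eval v B)
    (kalmar v A (⊢X ∘ ∈-++⁺ˡ)) (kalmar v B (⊢X ∘ ∈-++⁺ʳ (letters A)))
  kalmar v (□ A)    ⊢X = ⊢X (here refl)
  kalmar v (◇ A)    ⊢X = ⊢X (here refl)

  eliminate : ∀ ys → (∀ bs → literals ys bs ++ Γ ⊢ A) → Γ ⊢ A
  eliminate []                d = d []
  eliminate {Γ} {A} (y ∷ ys)  d = cases (deduction (case true)) (deduction (case false)) (thm (lem y))
    where
    case : ∀ b → lit b y ∷ Γ ⊢ A
    case b = eliminate ys λ bs →
      weaken (∈-resp-↭ (↭-sym (shift (lit b y) (literals ys bs) Γ))) (d (b ∷ bs))

  Taut⊆ : Taut ⊆ L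
  Taut⊆ {A} ⊨A = ⊢-closed (eliminate (letters A) λ bs → weaken ∈-++⁺ˡ (derive bs))
    where
    derive : ∀ bs → literals (letters A) bs ⊢ A
    derive bs = subst (λ b → literals (letters A) bs ⊢ lit b A) (⊨A v) (kalmar v A (hyp ∘ lit-valuation∈literals bs))
      where v = valuation (letters A) bs

K⊆Gen : ∀ {S} → LEM ⊆ S → K ⊆ Gen S
K⊆Gen {S} LEM⊆S = K⊆
  where
  excluded-middle : ∀ A → Gen S (A ∨′ ¬′ A)
  excluded-middle A = sb ⟨ A ∷ [] ⟩ (base (LEM⊆S lem))

  open Kalmar {Gen S} ipc mp excluded-middle using (Taut⊆)

  tautology : {IsTautology A} → Gen S A
  tautology {A} {t} = Taut⊆ (IsTautology⇒Taut A t)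

  ◇⇒¬□¬ : Gen S (◇ p ⇒ ¬′ (□ (¬′ p)))
  ◇⇒¬□¬ = mp (mp tautology (R3 {A = p} {B = ¬′ (□ (¬′ p))} {C = ⊥′} tautology)) (modax A4)

  ¬□¬⇒◇ : Gen S (¬′ (□ (¬′ p)) ⇒ ◇ p)
  ¬□¬⇒◇ = mp (mp tautology (R1 (excluded-middle p))) (sb ⟨ p ∷ ¬′ p ∷ [] ⟩ (modax A2))

  K⊆ : K ⊆ Gen S
  K⊆ (taut ⊨A) = Taut⊆ ⊨A
  K⊆ kax       = modax A1
  K⊆ dual      = mp (mp (ipc (∧i _ _)) ◇⇒¬□¬) ¬□¬⇒◇
  K⊆ (mp d e)  = mp (K⊆ d) (K⊆ e)
  K⊆ (nec d)   = R1 (K⊆ d)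
  K⊆ (sb σ d)  = sb σ (K⊆ d)

mainTheorem18 : (L : FmSet) → IsIML L → L ⊆ Lfbdc → (L ⊕ LEM) ≐ K
mainTheorem18 L _ L⊆Lfbdc = Gen⊆K [ Lfbdc⊆K ∘ L⊆Lfbdc , (λ { lem → K-tautology }) ] , K⊆Gen inj₂
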